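{- In a slick tree-decomposition $(B_x:x\in V(T))$ of a graph $G$, each vertex $v\in V(G)$ has spread at most $\deg_G(v)+1$.
   Context: Graphs are simple, undirected and finite. A tree-decomposition of $G$ is a collection $(B_x:x\in V(T))$, $T$ a non-empty tree, of subsets of $V(G)$ such that each edge of $G$ has both ends in some $B_x$ and for each $v\in V(G)$ the set $\{x:v\in B_x\}$ induces a non-empty connected subtree of $T$. It is rooted if $T$ is rooted. A rooted tree-decomposition is slick if for each edge $xy\in E(T)$ with $x$ the parent of $y$, and each vertex $v\in B_x\cap B_y$, we have $(N_G(v)\cap B_y)\setminus B_x\neq\emptyset$. The spread of $v$ is the number of nodes $x$ with $v\in B_x$. -}

module Defs where

open import Data.Nat using (ℕ; zero; suc; _+_; _≤_)
open import Data.Fin using (Fin)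
open import Data.Fin.Subset using (Subset; _∈_; _∉_)
open import Data.Fin.Subset.Properties using (_∈?_)
open import Data.Bool using (Bool; true; false)
open import Data.List using (List; length; filter; allFin)
open import Data.Product using (Σ; ∃; _×_; _,_)
open import Data.Sum using (_⊎_)
open import Relation.Binary.PropositionalEquality using (_≡_; _≢_)
open import Relation.Nullary using (¬_)
open import Relation.Nullary.Decidable using (⌊_⌋)
open import Function using (id; _∘_)

record Graph : Set where
  field
    n    : ℕ
    adj  : Fin n → Fin n → Bool
    sym  : ∀ u v → adj u v ≡ adj v u
    irr  : ∀ v → adj v v ≡ false

open Graph public

Adj : (G : Graph) → Fin (n G) → Fin (n G) → Set
Adj G u v = adj G u v ≡ true

deg : (G : Graph) → Fin (n G) → ℕ
deg G v = length (filter (λ u → adj G v u Data.Bool.≟ true) (allFin (n G)))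

iterate : ∀ {A : Set} → (A → A) → ℕ → A → A
iterate f zero    = id
iterate f (suc k) = f ∘ iterate f k

-- A rooted tree on node set Fin k, given by its root and parent map:
-- the root is its own parent, and every node reaches the root by
-- iterating the parent map.
record RootedTree : Set where
  field
    k       : ℕ
    root    : Fin k
    parent  : Fin k → Fin k
    parent-root : parent root ≡ root
    reaches : ∀ x → ∃ λ m → iterate parent m x ≡ root

open RootedTree public

TEdge : (T : RootedTree) → Fin (k T) → Fin (k T) → Set
TEdge T x y = (y ≢ root T × parent T y ≡ x) ⊎ (x ≢ root T × parent T x ≡ y)

data WalkIn (T : RootedTree) (P : Fin (k T) → Set) : Fin (k T) → Fin (k T) → Set where
  here : ∀ {x} → P x → WalkIn T P x x
  step : ∀ {x z y} → P x → TEdge T x z → WalkIn T P z y → WalkIn T P x y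

record TreeDecomposition (G : Graph) : Set where
  field
    T   : RootedTree
    bag : Fin (k T) → Subset (n G)
    edge-covered : ∀ u v → Adj G u v → ∃ λ x → u ∈ bag x × v ∈ bag x
    vertex-nonempty : ∀ v → ∃ λ x → v ∈ bag x
    vertex-connected : ∀ v x y → v ∈ bag x → v ∈ bag y →
                       WalkIn T (λ z → v ∈ bag z) x y

open TreeDecomposition public

Slick : {G : Graph} → TreeDecomposition G → Set
Slick {G} D = ∀ y → y ≢ root (T D) → ∀ v →
  v ∈ bag D (parent (T D) y) → v ∈ bag D y →
  ∃ λ u → Adj G v u × u ∈ bag D y × u ∉ bag D (parent (T D) y)

spread : {G : Graph} → TreeDecomposition G → Fin (n G) → ℕ
spread {G} D v = length (filter (λ x → v ∈? bag D x) (allFin (k (T D))))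

{-# OPTIONS --safe #-}
module Submission where

-- Call y the top node of a vertex w if w ∈ B_y and either y is the root or
-- w ∉ B_(parent y).  Since the nodes whose bags contain w form a subtree, w has
-- exactly one top node.  By slickness, every node y with v ∈ B_y is the top node
-- of v itself or of a neighbour of v (a neighbour in B_y \ B_(parent y)), so
-- the nodes containing v inject into the closed neighbourhood of v.

open import Defs hiding (sym)
open import Data.Nat using (zero; suc; _+_; _*_; _≤_)
open import Data.Nat.Properties using (*-suc; +-comm)
open import Data.Fin using (Fin; zero; suc; _↑ˡ_; _↑ʳ_; splitAt)
open import Data.Fin.Properties using (_≟_; injective⇒≤; ↑ˡ-injective; splitAt-↑ˡ; splitAt-↑ʳ)
open import Data.Fin.Subset using (_∈_)
open import Data.Fin.Subset.Properties using (_∈?_)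
open import Data.Bool using (true) renaming (_≟_ to _≟ᵇ_)
open import Data.List using (List; length; filter; allFin; lookup)
open import Data.List.Relation.Unary.All as All using ()
open import Data.List.Relation.Unary.AllPairs using (_∷_)
open import Data.List.Relation.Unary.Any using (index)
open import Data.List.Relation.Unary.Unique.Propositional using (Unique)
open import Data.List.Relation.Unary.Unique.Propositional.Properties using (allFin⁺; filter⁺)
open import Data.List.Membership.Propositional.Properties using (∈-filter⁺; ∈-filter⁻; ∈-lookup; ∈-allFin)
open import Data.List.Membership.Setoid.Properties using (index-injective)
open import Data.List.Membership.Propositional using () renaming (_∈_ to _∈ˡ_)
open import Data.Product using (∃; _×_; _,_; proj₁; proj₂)
open import Data.Sum as Sum using (_⊎_; inj₁; inj₂)
open import Function using (id; _∘_)
open import Level using (0ℓ)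
open import Relation.Binary.PropositionalEquality
open import Relation.Nullary using (¬_; yes; no; contradiction)
open import Relation.Unary using (Pred; Decidable)

module _ {A : Set} (f : A → A) where

  iterate-suc : ∀ m x → iterate f (suc m) x ≡ iterate f m (f x)
  iterate-suc zero    x = refl
  iterate-suc (suc m) x = cong f (iterate-suc m x)

  iterate-+ : ∀ m j x → iterate f (m + j) x ≡ iterate f m (iterate f j x)
  iterate-+ zero    j x = refl
  iterate-+ (suc m) j x = cong f (iterate-+ m j x)

  iterate-fixed : ∀ {r} → f r ≡ r → ∀ m → iterate f m r ≡ r
  iterate-fixed r-fixed zero    = refl
  iterate-fixed r-fixed (suc m) = trans (cong f (iterate-fixed r-fixed m)) r-fixed

  iterate-periodic : ∀ {y} c → iterate f c y ≡ y → ∀ t → iterate f (t * c) y ≡ y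
  iterate-periodic c y-periodic zero    = refl
  iterate-periodic {y} c y-periodic (suc t) = begin
    iterate f (c + t * c) y           ≡⟨ iterate-+ c (t * c) y ⟩
    iterate f c (iterate f (t * c) y) ≡⟨ cong (iterate f c) (iterate-periodic c y-periodic t) ⟩
    iterate f c y                     ≡⟨ y-periodic ⟩
    y                                 ∎
    where open ≡-Reasoning

  -- After m steps y is at r, where it stays; after m * suc c steps it is back at y.
  periodic⇒fixed : ∀ {r y c} → f r ≡ r → (∃ λ m → iterate f m y ≡ r) →
                   iterate f (suc c) y ≡ y → y ≡ r
  periodic⇒fixed {r} {y} {c} r-fixed (m , y↦r) y-periodic = begin
    y                                 ≡⟨ sym (iterate-periodic (suc c) y-periodic m) ⟩
    iterate f (m * suc c) y           ≡⟨ cong (λ l → iterate f l y) (trans (*-suc m c) (+-comm m (m * c))) ⟩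
    iterate f (m * c + m) y           ≡⟨ iterate-+ (m * c) m y ⟩
    iterate f (m * c) (iterate f m y) ≡⟨ cong (iterate f (m * c)) y↦r ⟩
    iterate f (m * c) r               ≡⟨ iterate-fixed r-fixed (m * c) ⟩
    r                                 ∎
    where open ≡-Reasoning

module _ (T : RootedTree) where

  _≼_ : Fin (k T) → Fin (k T) → Set
  y ≼ z = ∃ λ m → iterate (parent T) m z ≡ y

  ≼-refl : ∀ {y} → y ≼ y
  ≼-refl = 0 , refl

  ≼-antisym : ∀ {y z} → y ≼ z → z ≼ y → y ≡ z
  ≼-antisym (zero , z≡y) _ = sym z≡y
  ≼-antisym {y} {z} (suc m , z↦y) (j , y↦z) = trans y≡root (sym z≡root)
    where
    y≡root : y ≡ root T
    y≡root = periodic⇒fixed (parent T) {c = m + j} (parent-root T) (reaches T y)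
               (trans (iterate-+ (parent T) (suc m) j y) (trans (cong (iterate (parent T) (suc m)) y↦z) z↦y))
    z≡root : z ≡ root T
    z≡root = trans (sym y↦z) (trans (cong (iterate (parent T) j) y≡root) (iterate-fixed (parent T) (parent-root T) j))

  Topmost : Pred (Fin (k T)) 0ℓ → Fin (k T) → Set
  Topmost P y = y ≡ root T ⊎ ¬ P (parent T y)

  edge-preserves-≼-topmost : ∀ {P y a b} → Topmost P y → P b → TEdge T a b → y ≼ a → y ≼ b
  edge-preserves-≼-topmost _ _ (inj₁ (_ , b↦a)) (m , a↦y) =
    suc m , trans (iterate-suc (parent T) m _) (trans (cong (iterate (parent T) m) b↦a) a↦y)
  edge-preserves-≼-topmost (inj₁ y≡root) _ (inj₂ (a≢root , _)) (zero , refl) = contradiction y≡root a≢root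
  edge-preserves-≼-topmost (inj₂ ¬P[py]) Pb (inj₂ (_ , refl)) (zero , refl) = contradiction Pb ¬P[py]
  edge-preserves-≼-topmost _ _ (inj₂ (_ , a↦b)) (suc m , a↦y) =
    m , trans (cong (iterate (parent T) m) (sym a↦b)) (trans (sym (iterate-suc (parent T) m _)) a↦y)

  walk-head : ∀ {P a b} → WalkIn T P a b → P a
  walk-head (here Pa)     = Pa
  walk-head (step Pa _ _) = Pa

  walk-preserves-≼-topmost : ∀ {P y a b} → Topmost P y → WalkIn T P a b →
                             (y ≼ a → y ≼ b) × (y ≼ b → y ≼ a)
  walk-preserves-≼-topmost top (here _) = id , id
  walk-preserves-≼-topmost top (step Pa e w) with walk-preserves-≼-topmost top w
  ... | to , from = to ∘ edge-preserves-≼-topmost top (walk-head w) e ,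
                    edge-preserves-≼-topmost top Pa (Sum.swap e) ∘ from

  topmost-unique : ∀ {P y y'} → Topmost P y → Topmost P y' → WalkIn T P y y' → y ≡ y'
  topmost-unique top top' w =
    ≼-antisym (proj₁ (walk-preserves-≼-topmost top w) ≼-refl)
              (proj₂ (walk-preserves-≼-topmost top' w) ≼-refl)

lookup-injective : ∀ {A : Set} {xs : List A} → Unique xs → ∀ {i j} → lookup xs i ≡ lookup xs j → i ≡ j
lookup-injective (_ ∷ _) {zero} {zero} _ = refl
lookup-injective (x∉xs ∷ _) {zero} {suc j} x≡xs[j] = contradiction x≡xs[j] (All.lookup x∉xs (∈-lookup j))
lookup-injective (x∉xs ∷ _) {suc i} {zero} xs[i]≡x = contradiction (sym xs[i]≡x) (All.lookup x∉xs (∈-lookup i))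
lookup-injective (_ ∷ unique) {suc i} {suc j} e = cong suc (lookup-injective unique e)

injectiveOn⇒length-filter≤ : ∀ {a m} {P : Pred (Fin a) 0ℓ} (P? : Decidable P) (f : ∀ {x} → P x → Fin m) →
                             (∀ {x y} (Px : P x) (Py : P y) → f Px ≡ f Py → x ≡ y) →
                             length (filter P? (allFin a)) ≤ m
injectiveOn⇒length-filter≤ {a} {P = P} P? f f-injective = injective⇒≤ {f = f ∘ P-lookup} g-injective
  where
  S : List (Fin a)
  S = filter P? (allFin a)
  P-lookup : ∀ i → P (lookup S i)
  P-lookup i = proj₂ (∈-filter⁻ P? {xs = allFin a} (∈-lookup i))
  g-injective : ∀ {i j} → f (P-lookup i) ≡ f (P-lookup j) → i ≡ j
  g-injective {i} {j} e = lookup-injective (filter⁺ P? (allFin⁺ a)) (f-injective (P-lookup i) (P-lookup j) e)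

↑ˡ≢↑ʳ : ∀ {m n} (i : Fin m) (j : Fin n) → i ↑ˡ n ≢ m ↑ʳ j
↑ˡ≢↑ʳ {m} {n} i j e with trans (sym (splitAt-↑ˡ m i n)) (trans (cong (splitAt m) e) (splitAt-↑ʳ m n j))
... | ()

module _ (G : Graph) (v : Fin (n G)) where

  neighbours : List (Fin (n G))
  neighbours = filter (λ u → adj G v u ≟ᵇ true) (allFin (n G))

  adj⇒∈neighbours : ∀ {w} → Adj G v w → w ∈ˡ neighbours
  adj⇒∈neighbours {w} = ∈-filter⁺ (λ u → adj G v u ≟ᵇ true) (∈-allFin w)

  ClosedNeighbour : Fin (n G) → Set
  ClosedNeighbour w = Adj G v w ⊎ w ≡ v

  closedNeighbour-index : ∀ {w} → ClosedNeighbour w → Fin (deg G v + 1)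
  closedNeighbour-index (inj₁ v~w) = index (adj⇒∈neighbours v~w) ↑ˡ 1
  closedNeighbour-index (inj₂ _)   = deg G v ↑ʳ zero

  closedNeighbour-index-injective : ∀ {w w'} (c : ClosedNeighbour w) (c' : ClosedNeighbour w') →
                                    closedNeighbour-index c ≡ closedNeighbour-index c' → w ≡ w'
  closedNeighbour-index-injective (inj₁ v~w) (inj₁ v~w') e =
    index-injective (setoid (Fin (n G))) (adj⇒∈neighbours v~w) (adj⇒∈neighbours v~w') (↑ˡ-injective 1 _ _ e)
  closedNeighbour-index-injective (inj₁ _) (inj₂ _) e = contradiction e (↑ˡ≢↑ʳ _ _)
  closedNeighbour-index-injective (inj₂ _) (inj₁ _) e = contradiction (sym e) (↑ˡ≢↑ʳ _ _)
  closedNeighbour-index-injective (inj₂ w≡v) (inj₂ w'≡v) _ = trans w≡v (sym w'≡v)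

module _ {G : Graph} (D : TreeDecomposition G) where

  TopNodeOf : Fin (n G) → Fin (k (T D)) → Set
  TopNodeOf w y = w ∈ bag D y × Topmost (T D) (λ x → w ∈ bag D x) y

  topNodeOf-unique : ∀ {w y y'} → TopNodeOf w y → TopNodeOf w y' → y ≡ y'
  topNodeOf-unique (w∈By , top) (w∈By' , top') =
    topmost-unique (T D) top top' (vertex-connected D _ _ _ w∈By w∈By')

  TopNodeOfClosedNeighbour : Fin (n G) → Fin (k (T D)) → Set
  TopNodeOfClosedNeighbour v y = ∃ λ w → ClosedNeighbour G v w × TopNodeOf w y

  slick⇒topNodeOfClosedNeighbour : Slick D → ∀ {v y} → v ∈ bag D y → TopNodeOfClosedNeighbour v y
  slick⇒topNodeOfClosedNeighbour slick {v} {y} v∈By with y ≟ root (T D)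
  ... | yes y≡root = v , inj₂ refl , v∈By , inj₁ y≡root
  ... | no y≢root with v ∈? bag D (parent (T D) y)
  ...   | no v∉Bpy = v , inj₂ refl , v∈By , inj₂ v∉Bpy
  ...   | yes v∈Bpy with slick y y≢root v v∈Bpy v∈By
  ...     | u , v~u , u∈By , u∉Bpy = u , inj₁ v~u , u∈By , inj₂ u∉Bpy

  topNodeOfClosedNeighbour-index : ∀ {v y} → TopNodeOfClosedNeighbour v y → Fin (deg G v + 1)
  topNodeOfClosedNeighbour-index {v} (_ , c , _) = closedNeighbour-index G v c

  topNodeOfClosedNeighbour-index-injective : ∀ {v y y'} (t : TopNodeOfClosedNeighbour v y) (t' : TopNodeOfClosedNeighbour v y') →
                                   topNodeOfClosedNeighbour-index t ≡ topNodeOfClosedNeighbour-index t' → y ≡ y'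
  topNodeOfClosedNeighbour-index-injective {v} (_ , c , top) (_ , c' , top') e
    with refl ← closedNeighbour-index-injective G v c c' e = topNodeOf-unique top top'

lemma17 : (G : Graph) (D : TreeDecomposition G) → Slick D →
          (v : Fin (n G)) → spread D v ≤ deg G v + 1
lemma17 G D slick v =
  injectiveOn⇒length-filter≤ (λ x → v ∈? bag D x) (topNodeOfClosedNeighbour-index D ∘ top)
    (λ v∈By v∈By' → topNodeOfClosedNeighbour-index-injective D (top v∈By) (top v∈By'))
  where
  top : ∀ {y} → v ∈ bag D y → TopNodeOfClosedNeighbour D v y
  top = slick⇒topNodeOfClosedNeighbour D slick
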